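{- There exists a non-separable $2$-latin square of order $n$ if and only if $n\geq 3$.
   Context: For a positive integer $a$, $N(a)=\{1,\dots,a\}$. A $k$-latin square of order $n$ is an $n\times n$ array $L$ whose cell $(i,j)$ contains a multiset $L(i,j)$ of exactly $k$ elements of $N(n)$, such that each symbol of $N(n)$ occurs exactly $k$ times (counting multiplicity) in each row and exactly $k$ times in each column; a $1$-latin square is a latin square. The join of a $k_1$-latin square $L_1$ and a $k_2$-latin square $L_2$ of the same order is the $(k_1+k_2)$-latin square with cells $L_1(i,j)\cup L_2(i,j)$ (multiset union). A $k$-latin square is separable if there exist positive integers $k_1,k_2<k$ with $k_1+k_2=k$ such that it is the join of a $k_1$-latin square and a $k_2$-latin square; otherwise it is non-separable. (Thus a $2$-latin square is separable iff it is the join of two latin squares.) -}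

module Defs where

open import Data.Nat using (ℕ; zero; suc; _+_; _≤_)
open import Data.Fin using (Fin)
open import Data.Product using (Σ; _×_; ∃)
open import Relation.Binary.PropositionalEquality using (_≡_)
open import Relation.Nullary using (¬_)

Σ[<_]_ : (n : ℕ) → (Fin n → ℕ) → ℕ
Σ[< zero ] f = 0
Σ[< suc n ] f = f Fin.zero + Σ[< n ] (λ i → f (Fin.suc i))

-- An n×n array of multisets over the symbol set N(n) ≅ Fin n.
-- A multiset of symbols is given by its multiplicity function:
-- A i j s = multiplicity of symbol s in cell (i , j).
Array : ℕ → Set
Array n = Fin n → Fin n → Fin n → ℕ

record IsKLatin (n k : ℕ) (L : Array n) : Set where
  field
    cellSize  : ∀ i j → Σ[< n ] (λ s → L i j s) ≡ k
    rowCount  : ∀ i s → Σ[< n ] (λ j → L i j s) ≡ k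
    colCount  : ∀ j s → Σ[< n ] (λ i → L i j s) ≡ k

join : ∀ {n} → Array n → Array n → Array n
join L₁ L₂ i j s = L₁ i j s + L₂ i j s

IsJoinOf : (n k₁ k₂ : ℕ) → Array n → Set
IsJoinOf n k₁ k₂ L =
  Σ (Array n) λ L₁ → Σ (Array n) λ L₂ →
    IsKLatin n k₁ L₁ × IsKLatin n k₂ L₂ × (∀ i j s → L i j s ≡ join L₁ L₂ i j s)

Separable : (n k : ℕ) → Array n → Set
Separable n k L =
  Σ ℕ λ k₁ → Σ ℕ λ k₂ →
    (1 ≤ k₁) × (1 ≤ k₂) × (k₁ + k₂ ≡ k) × IsJoinOf n k₁ k₂ L

NonSeparable : (n k : ℕ) → Array n → Set
NonSeparable n k L = ¬ Separable n k L

module Submission where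

-- Orders 1 and 2: a 2-latin square of order 1 is twice the trivial latin square; one of
-- order 2 carries a = L 0 0 0 copies of each Cayley table entry and 2 ∸ a of the other
-- symbol, hence is the join of two shifted Cayley tables.  So no order below 3 works.
--
-- Orders N = m + 3: the cyclic array whose cell at offset d ≥ 3 is {d , d} and whose
-- cells at offsets 0, 1, 2 are {0,1}, {0,2}, {1,2}, except on rows 0, 1 × columns 1, 2
-- where symbols 1 and 2 are traded, is 2-latin.  A latin square inside it must pick one
-- symbol per cell without repeats in lines; following the forced picks through rows
-- 0, 1, 2, N-2, N-1 always ends in a repeated symbol, so it is non-separable.

open import Defs
open import Data.Nat using (ℕ; zero; suc; _+_; _∸_; _≤_; z≤n; s≤s)
open import Data.Nat.Properties
open import Data.Nat.DivMod using (_%_; _mod_; m%n%n≡m%n; %-distribˡ-+; [m+n]%n≡m%n; m<n⇒m%n≡m)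
open import Data.Fin as F using (Fin; toℕ)
open import Data.Fin.Patterns using (0F; 1F; 2F)
open import Data.Fin.Properties
  using (toℕ-injective; toℕ-fromℕ<; toℕ-fromℕ; toℕ-inject₁; toℕ<n; fromℕ≢inject₁)
open import Data.Fin.Permutation using (permutation)
open import Data.Bool using (Bool; true; false; if_then_else_; _∧_; _∨_)
open import Data.Bool.Properties using (∨-comm)
open import Data.Product using (Σ; ∃; _×_; _,_; proj₁; proj₂)
open import Data.Sum using (_⊎_; inj₁; inj₂; [_,_]′)
open import Data.Empty using (⊥; ⊥-elim)
open import Function.Bundles using (_⇔_; mk⇔)
open import Relation.Nullary.Decidable using (does; does-⇔; yes; no)
open import Relation.Binary.PropositionalEquality
import Algebra.Properties.CommutativeMonoid.Sum as Sum

module ℕ-Sum = Sum +-0-commutativeMonoid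

Σ≡sum : ∀ {n} (f : Fin n → ℕ) → Σ[< n ] f ≡ ℕ-Sum.sum f
Σ≡sum {zero}  f = refl
Σ≡sum {suc n} f = cong (f F.zero +_) (Σ≡sum (λ i → f (F.suc i)))

Σ-cong : ∀ {n} {f g : Fin n → ℕ} → (∀ i → f i ≡ g i) → Σ[< n ] f ≡ Σ[< n ] g
Σ-cong {zero}  f≗g = refl
Σ-cong {suc n} f≗g = cong₂ _+_ (f≗g F.zero) (Σ-cong (λ i → f≗g (F.suc i)))

Σ-zero : ∀ {n} {f : Fin n → ℕ} → (∀ i → f i ≡ 0) → Σ[< n ] f ≡ 0
Σ-zero {zero}  f≗0 = refl
Σ-zero {suc n} f≗0 = cong₂ _+_ (f≗0 F.zero) (Σ-zero (λ i → f≗0 (F.suc i)))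

Σ-+ : ∀ {n} (f g : Fin n → ℕ) → Σ[< n ] (λ i → f i + g i) ≡ Σ[< n ] f + Σ[< n ] g
Σ-+ f g = begin
  Σ[< _ ] (λ i → f i + g i)    ≡⟨ Σ≡sum (λ i → f i + g i) ⟩
  ℕ-Sum.sum (λ i → f i + g i)  ≡⟨ ℕ-Sum.∑-distrib-+ f g ⟩
  ℕ-Sum.sum f + ℕ-Sum.sum g    ≡⟨ cong₂ _+_ (Σ≡sum f) (Σ≡sum g) ⟨
  Σ[< _ ] f + Σ[< _ ] g        ∎
  where open ≡-Reasoning

Σ-reindex : ∀ {n} (σ τ : Fin n → Fin n) → (∀ y → σ (τ y) ≡ y) → (∀ x → τ (σ x) ≡ x) →
            (f : Fin n → ℕ) → Σ[< n ] f ≡ Σ[< n ] (λ x → f (σ x))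
Σ-reindex σ τ στ τσ f = begin
  Σ[< _ ] f                  ≡⟨ Σ≡sum f ⟩
  ℕ-Sum.sum f                ≡⟨ ℕ-Sum.sum-permute f (permutation σ τ στ τσ) ⟩
  ℕ-Sum.sum (λ x → f (σ x))  ≡⟨ Σ≡sum (λ x → f (σ x)) ⟨
  Σ[< _ ] (λ x → f (σ x))    ∎
  where open ≡-Reasoning

term≤Σ : ∀ {n} (f : Fin n → ℕ) i → f i ≤ Σ[< n ] f
term≤Σ f F.zero    = m≤m+n (f F.zero) _
term≤Σ f (F.suc i) = ≤-trans (term≤Σ (λ j → f (F.suc j)) i) (m≤n+m _ (f F.zero))

Σ-positive : ∀ {n} (f : Fin n → ℕ) → 1 ≤ Σ[< n ] f → ∃ λ i → 1 ≤ f i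
Σ-positive {suc n} f pos with f F.zero in f₀
... | suc _ = F.zero , subst (1 ≤_) (sym f₀) (s≤s z≤n)
... | zero  with Σ-positive (λ i → f (F.suc i)) pos
...   | i , fi = F.suc i , fi

Σ≤1-unique : ∀ {n} (f : Fin n → ℕ) {i j} → Σ[< n ] f ≤ 1 → 1 ≤ f i → 1 ≤ f j → i ≡ j
Σ≤1-unique f {F.zero}  {F.zero}  _ _ _ = refl
Σ≤1-unique f {F.zero}  {F.suc j} Σ≤1 fi fj =
  ⊥-elim (1+n≰n (≤-trans (+-mono-≤ fi (≤-trans fj (term≤Σ _ j))) Σ≤1))
Σ≤1-unique f {F.suc i} {F.zero}  Σ≤1 fi fj =
  ⊥-elim (1+n≰n (≤-trans (+-mono-≤ fj (≤-trans fi (term≤Σ _ i))) Σ≤1))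
Σ≤1-unique f {F.suc i} {F.suc j} Σ≤1 fi fj =
  cong F.suc (Σ≤1-unique (λ k → f (F.suc k)) (≤-trans (m≤n+m _ (f F.zero)) Σ≤1) fi fj)

δ : ∀ {n} → Fin n → Fin n → ℕ
δ F.zero    F.zero    = 1
δ F.zero    (F.suc _) = 0
δ (F.suc _) F.zero    = 0
δ (F.suc a) (F.suc s) = δ a s

δ-sym : ∀ {n} (a s : Fin n) → δ a s ≡ δ s a
δ-sym F.zero    F.zero    = refl
δ-sym F.zero    (F.suc _) = refl
δ-sym (F.suc _) F.zero    = refl
δ-sym (F.suc a) (F.suc s) = δ-sym a s

δ-positive : ∀ {n} {a s : Fin n} → 1 ≤ δ a s → a ≡ s
δ-positive {a = F.zero}  {F.zero}  _   = refl
δ-positive {a = F.suc a} {F.suc s} pos = cong F.suc (δ-positive pos)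

Σ-δ : ∀ {n} (a : Fin n) → Σ[< n ] (δ a) ≡ 1
Σ-δ {suc n} F.zero    = cong suc (Σ-zero {n} (λ _ → refl))
Σ-δ {suc n} (F.suc a) = Σ-δ a

Σ-δˡ : ∀ {n} (s : Fin n) → Σ[< n ] (λ a → δ a s) ≡ 1
Σ-δˡ s = trans (Σ-cong (λ a → δ-sym a s)) (Σ-δ s)

Pair : ℕ → Set
Pair n = Fin n × Fin n

⟦_⟧ : ∀ {n} → Pair n → Fin n → ℕ
⟦ a , b ⟧ s = δ a s + δ b s

_∈₂_ : ∀ {n} → Fin n → Pair n → Set
s ∈₂ (a , b) = s ≡ a ⊎ s ≡ b

⟦⟧-size : ∀ {n} (p : Pair n) → Σ[< n ] ⟦ p ⟧ ≡ 2
⟦⟧-size (a , b) = trans (Σ-+ (δ a) (δ b)) (cong₂ _+_ (Σ-δ a) (Σ-δ b))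

⟦⟧-member : ∀ {n} (p : Pair n) {s} → 1 ≤ ⟦ p ⟧ s → s ∈₂ p
⟦⟧-member (a , b) {s} pos with δ a s in δas
... | suc _ = inj₁ (sym (δ-positive (subst (1 ≤_) (sym δas) (s≤s z≤n))))
... | zero  = inj₂ (sym (δ-positive pos))

the-other : ∀ {n} {s a b : Fin n} → s ∈₂ (a , b) → s ≢ a → s ≡ b
the-other (inj₁ s≡a) s≢a = ⊥-elim (s≢a s≡a)
the-other (inj₂ s≡b) _   = s≡b

the-other′ : ∀ {n} {s a b : Fin n} → s ∈₂ (a , b) → s ≢ b → s ≡ a
the-other′ (inj₁ s≡a) _   = s≡a
the-other′ (inj₂ s≡b) s≢b = ⊥-elim (s≢b s≡b)

latin-below : ∀ {n} {L : Array n} → Separable n 2 L →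
              Σ (Array n) λ L₁ → IsKLatin n 1 L₁ × (∀ i j s → L₁ i j s ≤ L i j s)
latin-below (suc zero , _ , _ , _ , _ , L₁ , L₂ , latin₁ , _ , L≡) =
  L₁ , latin₁ , λ i j s → ≤-trans (m≤m+n _ _) (≤-reflexive (sym (L≡ i j s)))
latin-below (zero , _ , () , _)
latin-below (suc (suc _) , zero , _ , () , _)
latin-below (suc (suc k₁) , suc k₂ , _ , _ , sum≡2 , _)
  with () ← trans (sym (+-suc k₁ k₂)) (suc-injective (suc-injective sum≡2))

join-separable : ∀ {n} {L L₁ L₂ : Array n} → IsKLatin n 1 L₁ → IsKLatin n 1 L₂ →
                 (∀ i j s → L i j s ≡ L₁ i j s + L₂ i j s) → Separable n 2 L
join-separable {L₁ = L₁} {L₂} latin₁ latin₂ L≡ =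
  1 , 1 , s≤s z≤n , s≤s z≤n , refl , L₁ , L₂ , latin₁ , latin₂ , L≡

module Cyclic (n : ℕ) where

  N : ℕ
  N = suc n

  infixl 6 _⊕_ _⊖_

  _⊕_ : Fin N → Fin N → Fin N
  i ⊕ j = (toℕ i + toℕ j) mod N

  _⊖_ : Fin N → Fin N → Fin N
  j ⊖ i = (toℕ j + (N ∸ toℕ i)) mod N

  toℕ-mod : ∀ m → toℕ (m mod N) ≡ m % N
  toℕ-mod m = toℕ-fromℕ< _

  private
    %-absorbˡ : ∀ a b → (a % N + b) % N ≡ (a + b) % N
    %-absorbˡ a b = begin
      (a % N + b) % N              ≡⟨ %-distribˡ-+ (a % N) b N ⟩
      (a % N % N + b % N) % N      ≡⟨ cong (λ x → (x + b % N) % N) (m%n%n≡m%n a N) ⟩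
      (a % N + b % N) % N          ≡⟨ %-distribˡ-+ a b N ⟨
      (a + b) % N                  ∎
      where open ≡-Reasoning

    %-absorbʳ : ∀ a b → (a + b % N) % N ≡ (a + b) % N
    %-absorbʳ a b = begin
      (a + b % N) % N  ≡⟨ cong (_% N) (+-comm a (b % N)) ⟩
      (b % N + a) % N  ≡⟨ %-absorbˡ b a ⟩
      (b + a) % N      ≡⟨ cong (_% N) (+-comm b a) ⟩
      (a + b) % N      ∎
      where open ≡-Reasoning

    cancel : ∀ (a : Fin N) t → (toℕ a + t + (N ∸ toℕ a)) % N ≡ t % N
    cancel a t = begin
      (toℕ a + t + (N ∸ toℕ a)) % N    ≡⟨ cong (λ x → (x + (N ∸ toℕ a)) % N) (+-comm (toℕ a) t) ⟩
      (t + toℕ a + (N ∸ toℕ a)) % N    ≡⟨ cong (_% N) (+-assoc t (toℕ a) _) ⟩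
      (t + (toℕ a + (N ∸ toℕ a))) % N  ≡⟨ cong (λ x → (t + x) % N) (m+[n∸m]≡n (<⇒≤ (toℕ<n a))) ⟩
      (t + N) % N                      ≡⟨ [m+n]%n≡m%n t N ⟩
      t % N                            ∎
      where open ≡-Reasoning

    toℕ%N : ∀ (a : Fin N) → toℕ a % N ≡ toℕ a
    toℕ%N a = m<n⇒m%n≡m (toℕ<n a)

  ⊕-comm : ∀ i j → i ⊕ j ≡ j ⊕ i
  ⊕-comm i j = cong (_mod N) (+-comm (toℕ i) (toℕ j))

  ⊕-⊖ : ∀ i j → i ⊕ (j ⊖ i) ≡ j
  ⊕-⊖ i j = toℕ-injective (begin
    toℕ (i ⊕ (j ⊖ i))
      ≡⟨ toℕ-mod (toℕ i + toℕ (j ⊖ i)) ⟩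
    (toℕ i + toℕ (j ⊖ i)) % N
      ≡⟨ cong (λ x → (toℕ i + x) % N) (toℕ-mod (toℕ j + (N ∸ toℕ i))) ⟩
    (toℕ i + (toℕ j + (N ∸ toℕ i)) % N) % N
      ≡⟨ %-absorbʳ (toℕ i) _ ⟩
    (toℕ i + (toℕ j + (N ∸ toℕ i))) % N
      ≡⟨ cong (_% N) (+-assoc (toℕ i) (toℕ j) _) ⟨
    (toℕ i + toℕ j + (N ∸ toℕ i)) % N
      ≡⟨ cancel i (toℕ j) ⟩
    toℕ j % N
      ≡⟨ toℕ%N j ⟩
    toℕ j ∎)
    where open ≡-Reasoning

  ⊖-⊕ : ∀ i d → (i ⊕ d) ⊖ i ≡ d
  ⊖-⊕ i d = toℕ-injective (begin
    toℕ ((i ⊕ d) ⊖ i)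
      ≡⟨ toℕ-mod (toℕ (i ⊕ d) + (N ∸ toℕ i)) ⟩
    (toℕ (i ⊕ d) + (N ∸ toℕ i)) % N
      ≡⟨ cong (λ x → (x + (N ∸ toℕ i)) % N) (toℕ-mod (toℕ i + toℕ d)) ⟩
    ((toℕ i + toℕ d) % N + (N ∸ toℕ i)) % N
      ≡⟨ %-absorbˡ (toℕ i + toℕ d) _ ⟩
    (toℕ i + toℕ d + (N ∸ toℕ i)) % N
      ≡⟨ cancel i (toℕ d) ⟩
    toℕ d % N
      ≡⟨ toℕ%N d ⟩
    toℕ d ∎)
    where open ≡-Reasoning

  ⊖-cancelʳ : ∀ r d → (r ⊕ d) ⊖ d ≡ r
  ⊖-cancelʳ r d = trans (cong (_⊖ d) (⊕-comm r d)) (⊖-⊕ d r)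

  ⊖-involutive : ∀ j d → j ⊖ (j ⊖ d) ≡ d
  ⊖-involutive j d = trans (cong (_⊖ (j ⊖ d)) (sym (⊕-⊖ d j))) (⊖-cancelʳ d (j ⊖ d))

  ⊕-wrap : ∀ i d c → toℕ i + toℕ d ≡ toℕ c + N → i ⊕ d ≡ c
  ⊕-wrap i d c i+d≡c+N = toℕ-injective (begin
    toℕ (i ⊕ d)          ≡⟨ toℕ-mod (toℕ i + toℕ d) ⟩
    (toℕ i + toℕ d) % N  ≡⟨ cong (_% N) i+d≡c+N ⟩
    (toℕ c + N) % N      ≡⟨ [m+n]%n≡m%n (toℕ c) N ⟩
    toℕ c % N            ≡⟨ toℕ%N c ⟩
    toℕ c                ∎)
    where open ≡-Reasoning

  does-shift : ∀ j d r → does (j ⊖ d F.≟ r) ≡ does (j F.≟ r ⊕ d)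
  does-shift j d r = does-⇔ (mk⇔ to from) (j ⊖ d F.≟ r) (j F.≟ r ⊕ d)
    where
    to : j ⊖ d ≡ r → j ≡ r ⊕ d
    to refl = trans (sym (⊕-⊖ d j)) (⊕-comm d (j ⊖ d))
    from : j ≡ r ⊕ d → j ⊖ d ≡ r
    from refl = ⊖-cancelʳ r d

  Σ-along-row : ∀ i (f : Fin N → ℕ) → Σ[< N ] f ≡ Σ[< N ] (λ d → f (i ⊕ d))
  Σ-along-row i = Σ-reindex (i ⊕_) (_⊖ i) (⊕-⊖ i) (⊖-⊕ i)

  Σ-along-column : ∀ j (f : Fin N → ℕ) → Σ[< N ] f ≡ Σ[< N ] (λ d → f (j ⊖ d))
  Σ-along-column j = Σ-reindex (j ⊖_) (j ⊖_) (⊖-involutive j) (⊖-involutive j)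

  cyclic : (Fin N → Fin N → Fin N → ℕ) → Array N
  cyclic A i j = A i (j ⊖ i)

  cyclic-latin : ∀ {k} (A : Fin N → Fin N → Fin N → ℕ) →
                 (∀ r d → Σ[< N ] (A r d) ≡ k) →
                 (∀ r s → Σ[< N ] (λ d → A r d s) ≡ k) →
                 (∀ j s → Σ[< N ] (λ d → A (j ⊖ d) d s) ≡ k) →
                 IsKLatin N k (cyclic A)
  cyclic-latin A cells rows columns = record
    { cellSize = λ i j → cells i (j ⊖ i)
    ; rowCount = λ i s → begin
        Σ[< N ] (λ j → A i (j ⊖ i) s)
          ≡⟨ Σ-along-row i (λ j → A i (j ⊖ i) s) ⟩
        Σ[< N ] (λ d → A i ((i ⊕ d) ⊖ i) s)
          ≡⟨ Σ-cong (λ d → cong (λ x → A i x s) (⊖-⊕ i d)) ⟩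
        Σ[< N ] (λ d → A i d s)
          ≡⟨ rows i s ⟩
        _ ∎
    ; colCount = λ j s → begin
        Σ[< N ] (λ i → A i (j ⊖ i) s)
          ≡⟨ Σ-along-column j (λ i → A i (j ⊖ i) s) ⟩
        Σ[< N ] (λ d → A (j ⊖ d) (j ⊖ (j ⊖ d)) s)
          ≡⟨ Σ-cong (λ d → cong (λ x → A (j ⊖ d) x s) (⊖-involutive j d)) ⟩
        Σ[< N ] (λ d → A (j ⊖ d) d s)
          ≡⟨ columns j s ⟩
        _ ∎
    }
    where open ≡-Reasoning

  cayley : Fin N → Array N
  cayley t = cyclic (λ _ d → δ (t ⊕ d))

  cayley-latin : ∀ t → IsKLatin N 1 (cayley t)
  cayley-latin t =
    cyclic-latin (λ _ d → δ (t ⊕ d)) (λ _ d → Σ-δ (t ⊕ d)) (λ _ → each-once) (λ _ → each-once)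
    where
    each-once : ∀ s → Σ[< N ] (λ d → δ (t ⊕ d) s) ≡ 1
    each-once s = trans (sym (Σ-along-row t (λ x → δ x s))) (Σ-δˡ s)

order-one-separable : (L : Array 1) → IsKLatin 1 2 L → Separable 1 2 L
order-one-separable L latin = join-separable (cayley-latin 0F) (cayley-latin 0F) L≡
  where
  open Cyclic 0
  L≡ : ∀ i j s → L i j s ≡ cayley 0F i j s + cayley 0F i j s
  L≡ 0F 0F 0F = trans (sym (+-identityʳ _)) (IsKLatin.cellSize latin 0F 0F)

-- Order 2.  The multiset in a cell of a 2-latin square of order 2 is a copies of the
-- entry of the Cayley table of ℤ₂ and 2 ∸ a copies of the other symbol.
module ℤ₂ = Cyclic 1

weight : ℕ → ℕ → ℕ
weight a zero    = 2 ∸ a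
weight a (suc _) = a

weight-split : ∀ a → a ≤ 2 → ∃ λ t → ∃ λ t′ → ∀ (d s : Fin 2) →
               weight a (δ (0F ℤ₂.⊕ d) s) ≡ δ (t ℤ₂.⊕ d) s + δ (t′ ℤ₂.⊕ d) s
weight-split 0 _ = 1F , 1F , λ { 0F 0F → refl ; 0F 1F → refl ; 1F 0F → refl ; 1F 1F → refl }
weight-split 1 _ = 0F , 1F , λ { 0F 0F → refl ; 0F 1F → refl ; 1F 0F → refl ; 1F 1F → refl }
weight-split 2 _ = 0F , 0F , λ { 0F 0F → refl ; 0F 1F → refl ; 1F 0F → refl ; 1F 1F → refl }
weight-split (suc (suc (suc _))) (s≤s (s≤s ()))

module OrderTwo (L : Array 2) (latin : IsKLatin 2 2 L) where
  open ℤ₂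
  open IsKLatin latin

  a : ℕ
  a = L 0F 0F 0F

  a≤2 : a ≤ 2
  a≤2 = ≤-trans (m≤m+n a _) (≤-reflexive (cellSize 0F 0F))

  -- Each line sum has two terms, so either term determines the other.
  complement : (f : Fin 2 → ℕ) → Σ[< 2 ] f ≡ 2 → f 1F ≡ 2 ∸ f 0F
  complement f Σ≡2 =
    trans (sym (m+n∸m≡n (f 0F) (f 1F)))
          (cong (_∸ f 0F) (trans (cong (f 0F +_) (sym (+-identityʳ (f 1F)))) Σ≡2))

  complement² : (f : Fin 2 → ℕ) → Σ[< 2 ] f ≡ 2 → f 0F ≡ 2 ∸ a → f 1F ≡ a
  complement² f Σ≡2 f₀≡ = trans (complement f Σ≡2) (trans (cong (2 ∸_) f₀≡) (m∸[m∸n]≡n a≤2))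

  -- The eight entries, each obtained from an earlier one through a cell, row or column.
  entries : ∀ i j s → L i j s ≡ weight a (cayley 0F i j s)
  entries 0F 0F 0F = refl
  entries 0F 0F 1F = complement (L 0F 0F) (cellSize 0F 0F)
  entries 0F 1F 0F = complement (λ j → L 0F j 0F) (rowCount 0F 0F)
  entries 1F 0F 0F = complement (λ i → L i 0F 0F) (colCount 0F 0F)
  entries 0F 1F 1F = complement² (L 0F 1F) (cellSize 0F 1F) (entries 0F 1F 0F)
  entries 1F 0F 1F = complement² (L 1F 0F) (cellSize 1F 0F) (entries 1F 0F 0F)
  entries 1F 1F 0F = complement² (λ j → L 1F j 0F) (rowCount 1F 0F) (entries 1F 0F 0F)
  entries 1F 1F 1F = trans (complement (L 1F 1F) (cellSize 1F 1F))
                       (cong (2 ∸_) (complement² (λ j → L 1F j 0F) (rowCount 1F 0F) (entries 1F 0F 0F)))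

  separable : Separable 2 2 L
  separable with weight-split a a≤2
  ... | t , t′ , split =
    join-separable (cayley-latin t) (cayley-latin t′) (λ i j s → trans (entries i j s) (split (j ⊖ i) s))

module Construction (m : ℕ) where
  open Cyclic (suc (suc m))

  pattern big k = F.suc (F.suc (F.suc k))

  infix 4 _is_

  _is_ : Fin N → Fin N → Bool
  r is c = does (r F.≟ c)

  exclusive : ∀ {c c′} → c ≢ c′ → ∀ r → (r is c) ∧ (r is c′) ≡ false
  exclusive {c} {c′} c≢c′ r with r F.≟ c | r F.≟ c′
  ... | no _     | _        = refl
  ... | yes _    | no _     = refl
  ... | yes refl | yes refl = ⊥-elim (c≢c′ refl)

  -- The profile of a line, indexed by the offset d: the symbol d ≥ 3 fills the cell at
  -- offset d twice, while the offsets 0, 1, 2 share the symbols 0, 1, 2 in one of three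
  -- ways selected by two exclusive flags.
  shape : Bool → Bool → Fin N → Pair N
  shape a b 0F      = if a then (0F , 2F) else (0F , 1F)
  shape a b 1F      = if a ∨ b then (0F , 1F) else (0F , 2F)
  shape a b 2F      = if b then (2F , 2F) else (1F , 2F)
  shape a b (big k) = (big k , big k)

  rowShape : Fin N → Fin N → Pair N
  rowShape r = shape (r is 1F) (r is 0F)

  L⋆ : Array N
  L⋆ = cyclic (λ r d → ⟦ rowShape r d ⟧)

  columnShape : ∀ j d → rowShape (j ⊖ d) d ≡ shape (j is 1F) (j is 2F) d
  columnShape j 0F      = cong (λ a → shape a false 0F) (does-shift j 0F 1F)
  columnShape j 1F      = cong (λ c → if c then (0F , 1F) else (0F , 2F)) (begin
    (j ⊖ 1F is 1F) ∨ (j ⊖ 1F is 0F)  ≡⟨ cong₂ _∨_ (does-shift j 1F 1F) (does-shift j 1F 0F) ⟩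
    (j is 2F) ∨ (j is 1F)            ≡⟨ ∨-comm (j is 2F) (j is 1F) ⟩
    (j is 1F) ∨ (j is 2F)            ∎)
    where open ≡-Reasoning
  columnShape j 2F      = cong (λ b → shape false b 2F) (does-shift j 2F 0F)
  columnShape j (big k) = refl

  diagonal : ∀ k → Σ[< m ] (λ d → ⟦ big d , big d ⟧ (big k)) ≡ 2
  diagonal k = trans (Σ-+ (λ d → δ d k) (λ d → δ d k)) (cong₂ _+_ (Σ-δˡ k) (Σ-δˡ k))

  -- For exclusive flags every symbol occurs twice along a profile: the offsets 0, 1, 2
  -- hold each of 0, 1, 2 twice, and the symbols k ≥ 3 sit on their diagonal.
  shape-count : ∀ a b → a ∧ b ≡ false → ∀ s → Σ[< N ] (λ d → ⟦ shape a b d ⟧ s) ≡ 2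
  shape-count false false _ (big k) = diagonal k
  shape-count true  false _ (big k) = diagonal k
  shape-count false true  _ (big k) = diagonal k
  shape-count false false _ 0F = cong (2 +_) (Σ-zero {m} (λ _ → refl))
  shape-count false false _ 1F = cong (2 +_) (Σ-zero {m} (λ _ → refl))
  shape-count false false _ 2F = cong (2 +_) (Σ-zero {m} (λ _ → refl))
  shape-count true  false _ 0F = cong (2 +_) (Σ-zero {m} (λ _ → refl))
  shape-count true  false _ 1F = cong (2 +_) (Σ-zero {m} (λ _ → refl))
  shape-count true  false _ 2F = cong (2 +_) (Σ-zero {m} (λ _ → refl))
  shape-count false true  _ 0F = cong (2 +_) (Σ-zero {m} (λ _ → refl))
  shape-count false true  _ 1F = cong (2 +_) (Σ-zero {m} (λ _ → refl))
  shape-count false true  _ 2F = cong (2 +_) (Σ-zero {m} (λ _ → refl))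

  L⋆-latin : IsKLatin N 2 L⋆
  L⋆-latin = cyclic-latin (λ r d → ⟦ rowShape r d ⟧) (λ r d → ⟦⟧-size (rowShape r d)) rows columns
    where
    rows : ∀ r s → Σ[< N ] (λ d → ⟦ rowShape r d ⟧ s) ≡ 2
    rows r = shape-count (r is 1F) (r is 0F) (exclusive (λ ()) r)
    columns : ∀ j s → Σ[< N ] (λ d → ⟦ rowShape (j ⊖ d) d ⟧ s) ≡ 2
    columns j s = trans (Σ-cong (λ d → cong (λ p → ⟦ p ⟧ s) (columnShape j d)))
                        (shape-count (j is 1F) (j is 2F) (exclusive (λ ()) j) s)

  last penultimate : Fin N
  last        = F.fromℕ (suc (suc m))
  penultimate = F.inject₁ (F.fromℕ (suc m))

  last⊕1 : last ⊕ 1F ≡ 0F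
  last⊕1 = ⊕-wrap last 1F 0F (trans (cong (_+ 1) (toℕ-fromℕ (suc (suc m)))) (+-comm (suc (suc m)) 1))

  last⊕2 : last ⊕ 2F ≡ 1F
  last⊕2 = ⊕-wrap last 2F 1F (trans (cong (_+ 2) (toℕ-fromℕ (suc (suc m)))) (+-comm (suc (suc m)) 2))

  penultimate⊕2 : penultimate ⊕ 2F ≡ 0F
  penultimate⊕2 = ⊕-wrap penultimate 2F 0F
    (trans (cong (_+ 2) (trans (toℕ-inject₁ (F.fromℕ (suc m))) (toℕ-fromℕ (suc m)))) (+-comm (suc m) 2))

  module Inside (L₁ : Array N) (latin₁ : IsKLatin N 1 L₁)
                (L₁≤L⋆ : ∀ i j s → L₁ i j s ≤ L⋆ i j s) where
    open IsKLatin latin₁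

    private
      choice : ∀ r d → ∃ λ s → 1 ≤ L₁ r (r ⊕ d) s
      choice r d = Σ-positive (L₁ r (r ⊕ d)) (≤-reflexive (sym (cellSize r (r ⊕ d))))

    pick : Fin N → Fin N → Fin N
    pick r d = proj₁ (choice r d)

    pick-occurs : ∀ r d → 1 ≤ L₁ r (r ⊕ d) (pick r d)
    pick-occurs r d = proj₂ (choice r d)

    pick-allowed : ∀ r d → pick r d ∈₂ rowShape r d
    pick-allowed r d = ⟦⟧-member (rowShape r d) (begin
      1                                        ≤⟨ pick-occurs r d ⟩
      L₁ r (r ⊕ d) (pick r d)                  ≤⟨ L₁≤L⋆ r (r ⊕ d) (pick r d) ⟩
      ⟦ rowShape r ((r ⊕ d) ⊖ r) ⟧ (pick r d)  ≡⟨ cong (λ x → ⟦ rowShape r x ⟧ (pick r d)) (⊖-⊕ r d) ⟩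
      ⟦ rowShape r d ⟧ (pick r d)              ∎)
      where open ≤-Reasoning

    row-distinct : ∀ r d d′ → d ≢ d′ → pick r d ≢ pick r d′
    row-distinct r d d′ d≢d′ same = d≢d′ (begin
      d              ≡⟨ ⊖-⊕ r d ⟨
      (r ⊕ d) ⊖ r    ≡⟨ cong (_⊖ r) same-column ⟩
      (r ⊕ d′) ⊖ r   ≡⟨ ⊖-⊕ r d′ ⟩
      d′             ∎)
      where
      open ≡-Reasoning
      same-column : r ⊕ d ≡ r ⊕ d′
      same-column = Σ≤1-unique (λ j → L₁ r j (pick r d)) (≤-reflexive (rowCount r (pick r d)))
                      (pick-occurs r d) (subst (λ s → 1 ≤ L₁ r (r ⊕ d′) s) (sym same) (pick-occurs r d′))

    column-distinct : ∀ r d r′ d′ → r ⊕ d ≡ r′ ⊕ d′ → r ≢ r′ → pick r d ≢ pick r′ d′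
    column-distinct r d r′ d′ same-column r≢r′ same =
      r≢r′ (Σ≤1-unique (λ i → L₁ i (r ⊕ d) (pick r d)) (≤-reflexive (colCount (r ⊕ d) (pick r d)))
              (pick-occurs r d)
              (subst₂ (λ j s → 1 ≤ L₁ r′ j s) (sym same-column) (sym same) (pick-occurs r′ d′)))

    avoid : ∀ {x y c : Fin N} → x ≢ y → y ≡ c → x ≢ c
    avoid x≢y refl = x≢y

    -- The pick at row 1, offset 1 is 0 or 1; either choice forces a clash.
    clash : ⊥
    clash = [ from-0 , from-1 ]′ (pick-allowed 1F 1F)
      where
      -- Then rows 2 and 1 both put the symbol 2 into column 3.
      from-1 : pick 1F 1F ≡ 1F → ⊥
      from-1 p₁₁ = column-distinct 2F 1F 1F 2F refl (λ ()) (trans p₂₁ (sym p₁₂))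
        where
        p₂₀ : pick 2F 0F ≡ 0F
        p₂₀ = the-other′ (pick-allowed 2F 0F) (avoid (column-distinct 2F 0F 1F 1F refl (λ ())) p₁₁)
        p₂₁ : pick 2F 1F ≡ 2F
        p₂₁ = the-other (pick-allowed 2F 1F) (avoid (row-distinct 2F 1F 0F (λ ())) p₂₀)
        p₁₂ : pick 1F 2F ≡ 2F
        p₁₂ = the-other (pick-allowed 1F 2F) (avoid (row-distinct 1F 2F 1F (λ ())) p₁₁)

      -- Then row N-1 is left without an admissible symbol at offset 0.
      from-0 : pick 1F 1F ≡ 0F → ⊥
      from-0 p₁₁ = [ (λ pL₀ → row-distinct last 0F 1F (λ ()) (trans pL₀ (sym pL₁)))
                   , (λ pL₀ → row-distinct last 0F 2F (λ ()) (trans pL₀ (sym pL₂))) ]′ (pick-allowed last 0F)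
        where
        p₁₀ : pick 1F 0F ≡ 2F
        p₁₀ = the-other (pick-allowed 1F 0F) (avoid (row-distinct 1F 0F 1F (λ ())) p₁₁)
        pL₂ : pick last 2F ≡ 1F
        pL₂ = the-other′ (pick-allowed last 2F) (avoid (column-distinct last 2F 1F 0F last⊕2 (λ ())) p₁₀)
        p₀₁ : pick 0F 1F ≡ 0F
        p₀₁ = the-other′ (pick-allowed 0F 1F) (avoid (column-distinct 0F 1F last 2F (sym last⊕2) (λ ())) pL₂)
        p₀₀ : pick 0F 0F ≡ 1F
        p₀₀ = the-other (pick-allowed 0F 0F) (avoid (row-distinct 0F 0F 1F (λ ())) p₀₁)
        pP₂ : pick penultimate 2F ≡ 2F
        pP₂ = the-other (pick-allowed penultimate 2F)
                (avoid (column-distinct penultimate 2F 0F 0F penultimate⊕2 (λ ())) p₀₀)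
        pL₁ : pick last 1F ≡ 0F
        pL₁ = the-other′ (pick-allowed last 1F)
                (avoid (column-distinct last 1F penultimate 2F (trans last⊕1 (sym penultimate⊕2))
                                        fromℕ≢inject₁) pP₂)

  L⋆-non-separable : NonSeparable N 2 L⋆
  L⋆-non-separable separation with latin-below separation
  ... | L₁ , latin₁ , L₁≤L⋆ = Inside.clash L₁ latin₁ L₁≤L⋆

no-non-separable-below-three : ∀ n → 1 ≤ n →
  Σ (Array n) (λ L → IsKLatin n 2 L × NonSeparable n 2 L) → 3 ≤ n
no-non-separable-below-three 1 _ (L , latin , non-separable) =
  ⊥-elim (non-separable (order-one-separable L latin))
no-non-separable-below-three 2 _ (L , latin , non-separable) =
  ⊥-elim (non-separable (OrderTwo.separable L latin))
no-non-separable-below-three (suc (suc (suc _))) _ _ = s≤s (s≤s (s≤s z≤n))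

non-separable-from-three : ∀ n → 3 ≤ n → Σ (Array n) (λ L → IsKLatin n 2 L × NonSeparable n 2 L)
non-separable-from-three 1 (s≤s ())
non-separable-from-three 2 (s≤s (s≤s ()))
non-separable-from-three (suc (suc (suc m))) _ = L⋆ , L⋆-latin , L⋆-non-separable
  where open Construction m

mainTheorem4 : (n : ℕ) → 1 ≤ n →
    (Σ (Array n) (λ L → IsKLatin n 2 L × NonSeparable n 2 L)) ⇔ (3 ≤ n)
mainTheorem4 n 1≤n = mk⇔ (no-non-separable-below-three n 1≤n) (non-separable-from-three n)
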